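{- Let $m,n$ be positive integers with $1\le n\le \frac{m}{2}$, and let $G$ be a finite simple graph with minimum degree $\delta(G)\geq 1+n$ and isolated toughness $I(G)\geq \frac{1}{m-n}$. Then for every $n$-element subset $E'\subset E(G)$, the graph $G-E'$ has an $S(m)$-factor, i.e. a $[1,m]$-factor.
   Context: For a graph $G$ and $S\subseteq V(G)$, $i(G-S)$ denotes the number of isolated vertices of $G-S$. The isolated toughness of $G$ is $I(G)=\min\{|S|/i(G-S): S\subseteq V(G),\ i(G-S)\geq 2\}$ if $G$ is not complete, and $I(G)=|V(G)|-1$ if $G$ is complete. An $S(m)$-factor (star-factor) of $G$ is a $[1,m]$-factor, i.e. a spanning subgraph $H$ with $1\le d_H(x)\le m$ for all $x\in V(G)$. -}

module Defs where

open import Data.Nat using (ℕ; zero; suc; _+_; _≤_; _∸_)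
open import Data.Bool using (Bool; true; false; if_then_else_; _∧_; _∨_; not)
open import Data.Fin using (Fin; zero; suc; toℕ)
open import Data.Nat using (_<ᵇ_)
open import Data.Integer using (+_)
open import Data.Rational using (ℚ; _/_; 0ℚ)
open import Data.Product using (_×_; Σ; ∃)
open import Relation.Binary.PropositionalEquality using (_≡_; _≢_; cong; cong₂)
open import Relation.Nullary using (¬_)
open import Function using (_∘_)

countFin : ∀ {v} → (Fin v → Bool) → ℕ
countFin {zero}  f = 0
countFin {suc v} f = (if f zero then 1 else 0) + countFin (f ∘ suc)

allFin : ∀ {v} → (Fin v → Bool) → Bool
allFin {zero}  f = true
allFin {suc v} f = f zero ∧ allFin (f ∘ suc)

record Graph (v : ℕ) : Set where
  field
    adj   : Fin v → Fin v → Bool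
    sym   : ∀ x y → adj x y ≡ adj y x
    irrefl : ∀ x → adj x x ≡ false
open Graph public

degree : ∀ {v} → Graph v → Fin v → ℕ
degree G x = countFin (adj G x)

MinDegreeAtLeast : ∀ {v} → Graph v → ℕ → Set
MinDegreeAtLeast G d = ∀ x → d ≤ degree G x

IsComplete : ∀ {v} → Graph v → Set
IsComplete G = ∀ x y → x ≢ y → adj G x y ≡ true

VSet : ℕ → Set
VSet v = Fin v → Bool

card : ∀ {v} → VSet v → ℕ
card = countFin

-- x is an isolated vertex of G - S : x ∉ S and all neighbours of x lie in S
isolatedIn : ∀ {v} → Graph v → VSet v → Fin v → Bool
isolatedIn G S x = not (S x) ∧ allFin (λ y → not (adj G x y) ∨ S y)

iso : ∀ {v} → Graph v → VSet v → ℕ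
iso G S = countFin (isolatedIn G S)

-- the rational |S| / i(G-S)   (i(G-S) ≥ 2 whenever used; 0 otherwise)
ratio : ∀ {v} → Graph v → VSet v → ℚ
ratio G S with iso G S
... | zero  = 0ℚ
... | suc k = (+ card S) / suc k

IsIsolatedToughness : ∀ {v} → Graph v → ℚ → Set
IsIsolatedToughness {v} G r =
  (IsComplete G → r ≡ (+ (v ∸ 1)) / 1) ×
  (¬ IsComplete G →
     (Σ (VSet v) λ S → (2 ≤ iso G S) × (r ≡ ratio G S)) ×
     (∀ (S : VSet v) → 2 ≤ iso G S → r Data.Rational.≤ ratio G S))

-- 1 / k for positive k (value at k = 0 is irrelevant; only used with k ≥ 1)
recip : ℕ → ℚ
recip zero    = 0ℚ
recip (suc k) = (+ 1) / suc k

record EdgeSubset {v : ℕ} (G : Graph v) : Set where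
  field
    mem     : Fin v → Fin v → Bool
    memSym  : ∀ x y → mem x y ≡ mem y x
    memSub  : ∀ x y → mem x y ≡ true → adj G x y ≡ true
open EdgeSubset public

sumFin : ∀ {v} → (Fin v → ℕ) → ℕ
sumFin {zero}  f = 0
sumFin {suc v} f = f zero + sumFin (f ∘ suc)

-- |E'| : number of unordered pairs {x,y} in E' (each counted once, via x < y)
edgeCount : ∀ {v} {G : Graph v} → EdgeSubset G → ℕ
edgeCount E = sumFin λ x → countFin λ y → (toℕ x <ᵇ toℕ y) ∧ mem E x y

deleteEdges : ∀ {v} (G : Graph v) → EdgeSubset G → Graph v
deleteEdges G E = record
  { adj    = λ x y → adj G x y ∧ not (mem E x y)
  ; sym    = λ x y → cong₂ (λ a b → a ∧ not b) (Graph.sym G x y) (memSym E x y)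
  ; irrefl = λ x → cong (λ a → a ∧ not (mem E x x)) (irrefl G x)
  }

-- an S(m)-factor = [1,m]-factor of G: a spanning subgraph H (symmetric
-- relation contained in adj G) with 1 ≤ d_H(x) ≤ m for every vertex x
record StarFactor {v : ℕ} (G : Graph v) (m : ℕ) : Set where
  field
    hadj     : Fin v → Fin v → Bool
    hsym     : ∀ x y → hadj x y ≡ hadj y x
    hsub     : ∀ x y → hadj x y ≡ true → adj G x y ≡ true
    degLower : ∀ x → 1 ≤ countFin (hadj x)
    degUpper : ∀ x → countFin (hadj x) ≤ m

module Submission where

open import Data.Bool using (Bool; true; false; T; if_then_else_; _∧_; _∨_; not)
open import Data.Bool.Properties using (∧-identityʳ; ∧-zeroʳ; ∧-comm; ∨-comm; T-≡)
open import Data.Empty using (⊥-elim)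
open import Data.Fin using (Fin; zero; suc; _≟_; toℕ)
import Data.Fin.Properties as Fin
import Data.Integer as ℤ
import Data.Integer.Properties as ℤ
open import Data.List using (List; [_]; _++_; map; filter)
open import Data.List.Membership.Propositional using (_∈_; lose)
open import Data.List.Membership.Propositional.Properties using (∈-++⁺ˡ; ∈-++⁺ʳ; ∈-map⁺; ∈-filter⁺)
open import Data.List.Relation.Unary.All using (lookup)
open import Data.List.Relation.Unary.All.Properties using (all-filter)
open import Data.List.Relation.Unary.Any using (any?; satisfied)
import Data.List.Relation.Unary.Any as Any
open import Data.Nat using (ℕ; zero; suc; _+_; _*_; _∸_; _≤_; _<_; _≤?_; _<?_; _<ᵇ_; z≤n; s≤s; z<s; >-nonZero)
open import Data.Nat.Induction using (<-wellFounded)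
open import Data.Nat.Properties hiding (_≟_)
open import Data.Product using (_×_; ∃; _,_; proj₁; proj₂)
open import Data.Rational using (ℚ; _/_; 0ℚ) renaming (_≤_ to _≤ℚ_)
import Data.Rational.Properties as ℚ
import Data.Rational.Unnormalised as ℚᵘ
import Data.Rational.Unnormalised.Properties as ℚᵘ
open import Data.Sum using (_⊎_; inj₁; inj₂)
open import Data.Unit using (tt)
import Data.Vec.Functional as Vector
open import Function using (_∘_)
open import Function.Bundles using (Equivalence)
open import Induction.WellFounded using (Acc; acc)
open import Level using (Level)
open import Relation.Binary.Bundles using (TotalOrder; DecTotalOrder)
open import Relation.Binary.PropositionalEquality
  using (_≡_; _≢_; refl; sym; trans; cong; cong₂; subst; subst₂; _≗_; module ≡-Reasoning)
open import Relation.Nullary using (¬_; Dec; yes; no; does)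
open import Relation.Nullary.Decidable using (T?; ¬?; _×-dec_; _→-dec_; ⌊_⌋; fromWitness)
open import Relation.Unary using (Pred; Decidable)

open import Algebra.Properties.Semiring.Sum +-*-semiring
  using (sum; sum-cong-≗; ∑-distrib-+; ∑-comm; *-distribˡ-sum; sum-replicate-zero)

open import Defs renaming (sym to adj-sym)

-- Write G′ = G − E′. First, i(G′ − S) ≤ m|S| for every S. If S = ∅, every vertex loses at most
-- n ≤ δ(G) − 1 edges, so none becomes isolated. If |S| = 1, an isolated vertex of G′ − S has lost at
-- least n edges of E′, and E′ has only 2n edge ends, so there are at most 2 ≤ m of them. If |S| ≥ 2,
-- deleting E′ isolates at most 2n further vertices, while the toughness hypothesis gives
-- i(G − S) ≤ (m − n)|S| whenever i(G − S) ≥ 2; both cases end below m|S|.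
--
-- Second, a graph H with i(H − S) ≤ m|S| for all S has a [1,m]-factor when m ≥ 2. Taking
-- S = N(X) ∖ X, whose deletion isolates X ∖ N(X), yields Hall's condition |X| ≤ m|N(X)|, so by Hall's
-- theorem with capacities every vertex x can choose a neighbour p x with each vertex chosen at most m
-- times. The edges {x, p x} form a [1,m]-factor as soon as every vertex chosen m times lies on a
-- 2-cycle of p. A violating vertex w = p x whose chooser x is chosen fewer than m times is repaired by
-- setting p w = x, which creates a 2-cycle and destroys none. When no repair applies, the violating
-- vertices are closed under taking preimages, so counting their preimages gives m|R| ≤ |R|, i.e. R = ∅.

private variable v : ℕ

infix 4 _==_ _⊆_

-- Booleans, counting and sums over Fin v

_==_ : Fin v → Fin v → Bool
x == y = does (x ≟ y)

==⇒≡ : {x y : Fin v} → T (x == y) → x ≡ y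
==⇒≡ {x = x} {y} h with x ≟ y
... | yes x≡y = x≡y

≡⇒== : {x y : Fin v} → x ≡ y → T (x == y)
≡⇒== {x = x} {y} x≡y with x ≟ y
... | yes _   = tt
... | no x≢y = x≢y x≡y

==-refl : (x : Fin v) → T (x == x)
==-refl x = ≡⇒== {x = x} refl

==-sym : (x y : Fin v) → (x == y) ≡ (y == x)
==-sym x y with x ≟ y | y ≟ x
... | yes _   | yes _   = refl
... | no  _   | no  _   = refl
... | yes x≡y | no  y≢x = ⊥-elim (y≢x (sym x≡y))
... | no  x≢y | yes y≡x = ⊥-elim (x≢y (sym y≡x))

T-∧⁺ : {a b : Bool} → T a → T b → T (a ∧ b)
T-∧⁺ {true} _ tb = tb

T-∧⁻ : {a b : Bool} → T (a ∧ b) → T a × T b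
T-∧⁻ {true} tb = tt , tb

T-∨⁺ˡ : {a b : Bool} → T a → T (a ∨ b)
T-∨⁺ˡ {true} _ = tt

T-∨⁺ʳ : (a : Bool) {b : Bool} → T b → T (a ∨ b)
T-∨⁺ʳ true  _  = tt
T-∨⁺ʳ false tb = tb

T-not⁺ : {b : Bool} → ¬ T b → T (not b)
T-not⁺ {true}  ¬b = ¬b tt
T-not⁺ {false} _  = tt

T-not⁻ : {b : Bool} → T (not b) → ¬ T b
T-not⁻ {true} ()

T-not-∨⁻ : {a b : Bool} → T (not a ∨ b) → T a → T b
T-not-∨⁻ {true} tb _ = tb

T-not-∨⁺ : {a b : Bool} → (T a → T b) → T (not a ∨ b)
T-not-∨⁺ {true}  f = f tt
T-not-∨⁺ {false} f = tt

allFin⁺ : {f : Fin v → Bool} → (∀ i → T (f i)) → T (allFin f)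
allFin⁺ {zero}  h = tt
allFin⁺ {suc v} {f} h with f zero | h zero
... | true | _ = allFin⁺ (h ∘ suc)

allFin⁻ : {f : Fin v → Bool} → T (allFin f) → ∀ i → T (f i)
allFin⁻ {suc v} {f} h i with f zero in e
allFin⁻ {suc v} {f} h zero    | true = subst T (sym e) tt
allFin⁻ {suc v} {f} h (suc i) | true = allFin⁻ h i

allFin-cong : {f g : Fin v → Bool} → (∀ i → f i ≡ g i) → allFin f ≡ allFin g
allFin-cong {zero}  e = refl
allFin-cong {suc v} e = cong₂ _∧_ (e zero) (allFin-cong (e ∘ suc))

_⊆_ : (Fin v → Bool) → (Fin v → Bool) → Set
X ⊆ Y = ∀ x → T (X x) → T (Y x)

indicator : Bool → ℕ
indicator b = if b then 1 else 0

indicator-true : {b : Bool} → T b → indicator b ≡ 1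
indicator-true {true} _ = refl

count-cong : {f g : Fin v → Bool} → (∀ i → f i ≡ g i) → countFin f ≡ countFin g
count-cong {zero}  e = refl
count-cong {suc v} e = cong₂ (λ b n → indicator b + n) (e zero) (count-cong (e ∘ suc))

count-mono : {f g : Fin v → Bool} → f ⊆ g → countFin f ≤ countFin g
count-mono {zero}  h = z≤n
count-mono {suc v} {f} {g} h with f zero | g zero | h zero
... | true  | true  | _ = s≤s (count-mono (h ∘ suc))
... | true  | false | h₀ = ⊥-elim (h₀ tt)
... | false | true  | _ = m≤n⇒m≤1+n (count-mono (h ∘ suc))
... | false | false | _ = count-mono (h ∘ suc)

count≡0 : (f : Fin v → Bool) → (∀ i → ¬ T (f i)) → countFin f ≡ 0
count≡0 {zero}  f h = refl
count≡0 {suc v} f h with f zero | h zero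
... | true  | h₀ = ⊥-elim (h₀ tt)
... | false | _  = count≡0 (f ∘ suc) (h ∘ suc)

count-== : (a : Fin v) → countFin (_== a) ≡ 1
count-== {suc v} zero    = cong suc (count≡0 {v} (λ i → suc i == zero) (λ _ ()))
count-== {suc v} (suc a) = count-== a

count-pos : (f : Fin v → Bool) (i : Fin v) → T (f i) → 0 < countFin f
count-pos f i fi = subst (_≤ countFin f) (count-== i) (count-mono {f = _== i} singleton⊆f)
  where
  singleton⊆f : (_== i) ⊆ f
  singleton⊆f j j=i = subst (T ∘ f) (sym (==⇒≡ j=i)) fi

count-witness : (f : Fin v → Bool) → 0 < countFin f → ∃ λ i → T (f i)
count-witness {suc v} f pos with f zero in e
... | true  = zero , subst T (sym e) tt
... | false = let i , fi = count-witness (f ∘ suc) pos in suc i , fi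

count≤size : (f : Fin v → Bool) → countFin f ≤ v
count≤size {zero}  f = z≤n
count≤size {suc v} f with f zero
... | true  = s≤s (count≤size (f ∘ suc))
... | false = m≤n⇒m≤1+n (count≤size (f ∘ suc))

count≤1 : (f : Fin v → Bool) → (∀ i j → T (f i) → T (f j) → i ≡ j) → countFin f ≤ 1
count≤1 {zero}  f uniq = z≤n
count≤1 {suc v} f uniq with f zero in e
... | true  = ≤-reflexive (cong suc (count≡0 (f ∘ suc) (λ i fi → Fin.0≢1+n (uniq zero (suc i) (subst T (sym e) tt) fi))))
... | false = count≤1 (f ∘ suc) (λ i j fi fj → Fin.suc-injective (uniq (suc i) (suc j) fi fj))

count-∨ : (f g : Fin v → Bool) → countFin (λ i → f i ∨ g i) ≤ countFin f + countFin g
count-∨ {zero}  f g = z≤n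
count-∨ {suc v} f g with f zero | g zero
... | true  | true  = s≤s (≤-trans (count-∨ (f ∘ suc) (g ∘ suc)) (+-monoʳ-≤ _ (n≤1+n _)))
... | true  | false = s≤s (count-∨ (f ∘ suc) (g ∘ suc))
... | false | true  = ≤-trans (s≤s (count-∨ (f ∘ suc) (g ∘ suc))) (≤-reflexive (sym (+-suc _ _)))
... | false | false = count-∨ (f ∘ suc) (g ∘ suc)

count-∨-disjoint : (f g : Fin v → Bool) → (∀ i → T (f i) → ¬ T (g i)) →
                   countFin (λ i → f i ∨ g i) ≡ countFin f + countFin g
count-∨-disjoint {zero}  f g disj = refl
count-∨-disjoint {suc v} f g disj with f zero | g zero | disj zero
... | true  | true  | d = ⊥-elim (d tt tt)
... | true  | false | _ = cong suc (count-∨-disjoint (f ∘ suc) (g ∘ suc) (disj ∘ suc))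
... | false | true  | _ = trans (cong suc (count-∨-disjoint (f ∘ suc) (g ∘ suc) (disj ∘ suc))) (sym (+-suc _ _))
... | false | false | _ = count-∨-disjoint (f ∘ suc) (g ∘ suc) (disj ∘ suc)

count-split : (f g : Fin v → Bool) →
  countFin f ≡ countFin (λ i → f i ∧ g i) + countFin (λ i → f i ∧ not (g i))
count-split {zero}  f g = refl
count-split {suc v} f g with f zero | g zero
... | true  | true  = cong suc (count-split (f ∘ suc) (g ∘ suc))
... | true  | false = trans (cong suc (count-split (f ∘ suc) (g ∘ suc))) (sym (+-suc _ _))
... | false | _     = count-split (f ∘ suc) (g ∘ suc)

count-< : {f g : Fin v → Bool} (i : Fin v) → f ⊆ g → T (g i) → ¬ T (f i) → countFin f < countFin g
count-< {f = f} {g} i f⊆g gi ¬fi = begin-strict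
  countFin f                                                       ≤⟨ count-mono f⊆g∧f ⟩
  countFin (λ j → g j ∧ f j)                                       <⟨ m<m+n _ (count-pos _ i g∧¬f[i]) ⟩
  countFin (λ j → g j ∧ f j) + countFin (λ j → g j ∧ not (f j))   ≡⟨ count-split g f ⟨
  countFin g                                                       ∎
  where
  open ≤-Reasoning
  f⊆g∧f : f ⊆ λ j → g j ∧ f j
  f⊆g∧f j fj = T-∧⁺ (f⊆g j fj) fj
  g∧¬f[i] : T (g i ∧ not (f i))
  g∧¬f[i] with f i
  ... | true  = ⊥-elim (¬fi tt)
  ... | false = T-∧⁺ gi tt

count-remove< : (f g : Fin v → Bool) (i : Fin v) → T (f i) → T (g i) →
                countFin (λ j → f j ∧ not (g j)) < countFin f
count-remove< f g i fi gi = count-< i (λ j → proj₁ ∘ T-∧⁻) fi (removed (g i) gi)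
  where
  removed : ∀ b → T b → ¬ T (f i ∧ not b)
  removed true _ h = proj₂ (T-∧⁻ {f i} h)

count-==-∧ : (x : Fin v) (b : Bool) → countFin (λ u → (u == x) ∧ b) ≡ indicator b
count-==-∧ {v} x true  = trans (count-cong (λ u → ∧-identityʳ (u == x))) (count-== x)
count-==-∧ {v} x false = trans (count-cong (λ u → ∧-zeroʳ (u == x))) (count≡0 {v} (λ _ → false) (λ _ ()))

count≡sum : (f : Fin v → Bool) → countFin f ≡ sum (indicator ∘ f)
count≡sum {zero}  f = refl
count≡sum {suc v} f = cong (indicator (f zero) +_) (count≡sum (f ∘ suc))

sumFin≡sum : (f : Fin v → ℕ) → sumFin f ≡ sum f
sumFin≡sum {zero}  f = refl
sumFin≡sum {suc v} f = cong (f zero +_) (sumFin≡sum (f ∘ suc))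

sum-mono : {f g : Fin v → ℕ} → (∀ i → f i ≤ g i) → sum f ≤ sum g
sum-mono {zero}  h = z≤n
sum-mono {suc v} h = +-mono-≤ (h zero) (sum-mono (h ∘ suc))

sum-pos : (f : Fin v → ℕ) → 0 < sum f → ∃ λ i → 0 < f i
sum-pos {suc v} f pos with f zero in e
... | suc _ = zero , subst (0 <_) (sym e) (s≤s z≤n)
... | zero  = let i , fi = sum-pos (f ∘ suc) pos in suc i , fi

∑-δ : (y : Fin v) (c : ℕ) → sum (λ z → if y == z then c else 0) ≡ c
∑-δ {suc v} zero    c = trans (cong (c +_) (sum-replicate-zero v)) (+-identityʳ c)
∑-δ {suc v} (suc y) c = ∑-δ y c

load : (Fin v → Bool) → (Fin v → Fin v) → Fin v → ℕ
load L p y = countFin λ x → L x ∧ (p x == y)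

∑-load : (L : Fin v → Bool) (p : Fin v → Fin v) → sum (load L p) ≡ countFin L
∑-load {v} L p = begin
  sum (λ y → countFin (λ x → L x ∧ (p x == y)))          ≡⟨ sum-cong-≗ (λ y → count≡sum (λ x → L x ∧ (p x == y))) ⟩
  sum (λ y → sum (λ x → indicator (L x ∧ (p x == y))))   ≡⟨ ∑-comm (λ y x → indicator (L x ∧ (p x == y))) ⟩
  sum (λ x → sum (λ y → indicator (L x ∧ (p x == y))))   ≡⟨ sum-cong-≗ one-term ⟩
  sum (indicator ∘ L)                                     ≡⟨ count≡sum L ⟨
  countFin L                                              ∎
  where
  open ≡-Reasoning
  one-term : ∀ x → sum (λ y → indicator (L x ∧ (p x == y))) ≡ indicator (L x)
  one-term x with L x
  ... | true  = ∑-δ (p x) 1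
  ... | false = sum-replicate-zero v

-- Searching the subsets of a finite set

subsets : (v : ℕ) → List (Fin v → Bool)
subsets zero    = [ (λ ()) ]
subsets (suc v) = map (true Vector.∷_) (subsets v) ++ map (false Vector.∷_) (subsets v)

subsets-complete : (S : Fin v → Bool) → ∃ λ S′ → S′ ∈ subsets v × S′ ≗ S
subsets-complete {zero}  S = (λ ()) , Any.here refl , λ ()
subsets-complete {suc v} S with subsets-complete (S ∘ suc) | S zero in S₀
... | S′ , S′∈ , S′≗ | true  = _ , ∈-++⁺ˡ (∈-map⁺ _ S′∈) , λ { zero → sym S₀ ; (suc i) → S′≗ i }
... | S′ , S′∈ , S′≗ | false = _ , ∈-++⁺ʳ _ (∈-map⁺ _ S′∈) , λ { zero → sym S₀ ; (suc i) → S′≗ i }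

module _ {ℓ : Level} {P : Pred (Fin v → Bool) ℓ}
         (P-resp : ∀ {S S′} → S ≗ S′ → P S → P S′) (P? : Decidable P) where

  any-subset? : Dec (∃ P)
  any-subset? with any? P? (subsets v)
  ... | yes found = yes (satisfied found)
  ... | no  none  = no λ (S , PS) →
    let S′ , S′∈ , S′≗S = subsets-complete S in none (lose S′∈ (P-resp (sym ∘ S′≗S) PS))

  module _ {b ℓ₁ ℓ₂} (O : TotalOrder b ℓ₁ ℓ₂) where
    open TotalOrder O using () renaming (Carrier to B; _≤_ to _≼_)
    open import Data.List.Extrema O using (argmin; argmin-all; f[argmin]≤f[xs])

    argmin-subset : (f : (Fin v → Bool) → B) → (∀ {S S′} → S ≗ S′ → f S ≡ f S′) →
                    ∃ P → ∃ λ S → P S × (∀ S′ → P S′ → f S ≼ f S′)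
    argmin-subset f f-cong (S , PS) = S₀ , P[S₀] , minimal
      where
      candidates : List (Fin v → Bool)
      candidates = filter P? (subsets v)
      S₀ : Fin v → Bool
      S₀ = argmin f S candidates
      P[S₀] : P S₀
      P[S₀] = argmin-all f PS (all-filter P? (subsets v))
      minimal : ∀ S′ → P S′ → f S₀ ≼ f S′
      minimal S′ PS′ with subsets-complete S′
      ... | S″ , S″∈ , S″≗S′ = subst (f S₀ ≼_) (f-cong S″≗S′)
        (lookup (f[argmin]≤f[xs] S candidates) (∈-filter⁺ P? S″∈ (P-resp (sym ∘ S″≗S′) PS′)))

-- Hall's theorem with capacities

module HallWithCapacities {v : ℕ} (A : Fin v → Fin v → Bool) where

  neighbours : (Fin v → Bool) → Fin v → Bool
  neighbours X y = does (Fin.any? λ x → T? (X x ∧ A x y))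

  neighbours⁺ : {X : Fin v → Bool} {x y : Fin v} → T (X x) → T (A x y) → T (neighbours X y)
  neighbours⁺ {X} {x} {y} Xx Axy with Fin.any? (λ x → T? (X x ∧ A x y))
  ... | yes _    = tt
  ... | no  none = none (x , T-∧⁺ Xx Axy)

  neighbours⁻ : {X : Fin v → Bool} {y : Fin v} → T (neighbours X y) → ∃ λ x → T (X x) × T (A x y)
  neighbours⁻ {X} {y} N with Fin.any? (λ x → T? (X x ∧ A x y))
  ... | yes (x , XAx) = x , T-∧⁻ XAx

  neighbours-cong : {X Y : Fin v → Bool} → X ≗ Y → ∀ y → neighbours X y ≡ neighbours Y y
  neighbours-cong {X} {Y} X≗Y y with Fin.any? (λ x → T? (X x ∧ A x y)) | Fin.any? (λ x → T? (Y x ∧ A x y))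
  ... | yes _        | yes _       = refl
  ... | no  _        | no  _       = refl
  ... | yes (x , Xx) | no  noneY   = ⊥-elim (noneY (x , subst (λ b → T (b ∧ A x y)) (X≗Y x) Xx))
  ... | no  noneX    | yes (x , Yx) = ⊥-elim (noneX (x , subst (λ b → T (b ∧ A x y)) (sym (X≗Y x)) Yx))

  capacity : (Fin v → ℕ) → (Fin v → Bool) → ℕ
  capacity c X = sum λ y → if neighbours X y then c y else 0

  capacity-cong : (c : Fin v → ℕ) {X Y : Fin v → Bool} → X ≗ Y → capacity c X ≡ capacity c Y
  capacity-cong c X≗Y = sum-cong-≗ λ y → cong (λ b → if b then c y else 0) (neighbours-cong X≗Y y)

  HallCondition : (Fin v → Bool) → (Fin v → ℕ) → Set
  HallCondition L c = ∀ X → X ⊆ L → countFin X ≤ capacity c X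

  record Assignment (L : Fin v → Bool) (c : Fin v → ℕ) : Set where
    field
      choice   : Fin v → Fin v
      adjacent : ∀ x → T (L x) → T (A x (choice x))
      load≤    : ∀ y → load L choice y ≤ c y
  open Assignment

  assign-empty : {L : Fin v → Bool} (c : Fin v → ℕ) → countFin L ≡ 0 → Assignment L c
  assign-empty {L} c L≡0 = record
    { choice   = λ x → x
    ; adjacent = λ x Lx → ⊥-elim (<-irrefl (sym L≡0) (count-pos L x Lx))
    ; load≤    = λ y → ≤-trans (count-mono {g = L} (λ x → proj₁ ∘ T-∧⁻)) (subst (_≤ c y) (sym L≡0) z≤n)
    }

  assign-singleton : {x y : Fin v} → T (A x y) → Assignment (_== x) (λ z → indicator (y == z))
  assign-singleton {x} {y} Axy = record
    { choice   = λ _ → y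
    ; adjacent = λ u u=x → subst (λ u → T (A u y)) (sym (==⇒≡ u=x)) Axy
    ; load≤    = λ z → ≤-reflexive (count-==-∧ x (y == z))
    }

  weaken : {L L′ : Fin v → Bool} {c c′ : Fin v → ℕ} →
           Assignment L c → L′ ⊆ L → (∀ y → c y ≤ c′ y) → Assignment L′ c′
  weaken a L′⊆L c≤c′ = record
    { choice   = choice a
    ; adjacent = λ x → adjacent a x ∘ L′⊆L x
    ; load≤    = λ y → ≤-trans (count-mono (λ x L′∧ → let L′x , px=y = T-∧⁻ L′∧ in T-∧⁺ (L′⊆L x L′x) px=y))
                               (≤-trans (load≤ a y) (c≤c′ y))
    }

  merge : {L₁ L₂ : Fin v → Bool} {c₁ c₂ : Fin v → ℕ} → Assignment L₁ c₁ → Assignment L₂ c₂ →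
          Assignment (λ x → L₁ x ∨ L₂ x) (λ y → c₁ y + c₂ y)
  merge {L₁} {L₂} a₁ a₂ = record
    { choice   = p
    ; adjacent = adjacent-p
    ; load≤    = λ y → ≤-trans (load-split y) (+-mono-≤ (load≤ a₁ y) (load≤ a₂ y))
    }
    where
    p : Fin v → Fin v
    p x = if L₁ x then choice a₁ x else choice a₂ x
    adjacent-p : ∀ x → T (L₁ x ∨ L₂ x) → T (A x (p x))
    adjacent-p x L with L₁ x in e
    ... | true  = adjacent a₁ x (subst T (sym e) tt)
    ... | false = adjacent a₂ x L
    by-side : ∀ y x → T ((L₁ x ∨ L₂ x) ∧ (p x == y)) →
              T ((L₁ x ∧ (choice a₁ x == y)) ∨ (L₂ x ∧ (choice a₂ x == y)))
    by-side y x h with L₁ x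
    ... | true  = T-∨⁺ˡ h
    ... | false = h
    load-split : ∀ y → load (λ x → L₁ x ∨ L₂ x) p y ≤ load L₁ (choice a₁) y + load L₂ (choice a₂) y
    load-split y = ≤-trans (count-mono (by-side y))
      (count-∨ (λ x → L₁ x ∧ (choice a₁ x == y)) (λ x → L₂ x ∧ (choice a₂ x == y)))

  restrict : {L : Fin v → Bool} {c : Fin v → ℕ} → Assignment L c →
             Assignment L (λ y → if neighbours L y then c y else 0)
  restrict {L} {c} a = record { choice = choice a ; adjacent = adjacent a ; load≤ = bound }
    where
    bound : ∀ y → load L (choice a) y ≤ (if neighbours L y then c y else 0)
    bound y with neighbours L y in e
    ... | true  = load≤ a y
    ... | false = ≤-reflexive (count≡0 _ λ x Lx∧ →
      let Lx , px=y = T-∧⁻ Lx∧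
      in subst T e (neighbours⁺ Lx (subst (T ∘ A x) (==⇒≡ px=y) (adjacent a x Lx))))

  neighbours-∨⁻ : (X Y : Fin v → Bool) {y : Fin v} → T (neighbours (λ x → X x ∨ Y x) y) →
                  T (neighbours X y) ⊎ T (neighbours Y y)
  neighbours-∨⁻ X Y N with neighbours⁻ N
  ... | x , XYx , Axy with X x in e
  ...   | true  = inj₁ (neighbours⁺ (subst T (sym e) tt) Axy)
  ...   | false = inj₂ (neighbours⁺ XYx Axy)

  capacity-∨ : (c : Fin v → ℕ) (Z X : Fin v → Bool) →
               capacity c (λ x → Z x ∨ X x) ≤ capacity (λ y → if neighbours X y then 0 else c y) Z + capacity c X
  capacity-∨ c Z X = ≤-trans (sum-mono pointwise) (≤-reflexive (∑-distrib-+
      (λ y → if neighbours Z y then (if neighbours X y then 0 else c y) else 0)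
      (λ y → if neighbours X y then c y else 0)))
    where
    pointwise : ∀ y → (if neighbours (λ x → Z x ∨ X x) y then c y else 0) ≤
                      (if neighbours Z y then (if neighbours X y then 0 else c y) else 0) + (if neighbours X y then c y else 0)
    pointwise y with neighbours Z y in eZ | neighbours X y in eX | neighbours (λ x → Z x ∨ X x) y in e
    ... | _     | _     | false = z≤n
    ... | _     | true  | true  = m≤n+m _ _
    ... | true  | false | true  = m≤m+n _ _
    ... | false | false | true  with neighbours-∨⁻ Z X (subst T (sym e) tt)
    ...   | inj₁ NZ = ⊥-elim (subst T eZ NZ)
    ...   | inj₂ NX = ⊥-elim (subst T eX NX)

  capacity-∸ : (c : Fin v → ℕ) (y : Fin v) (Z : Fin v → Bool) →
               capacity c Z ≤ suc (capacity (λ z → c z ∸ indicator (y == z)) Z)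
  capacity-∸ c y Z = begin
    capacity c Z                                    ≤⟨ sum-mono pointwise ⟩
    sum (λ z → indicator (y == z) + lowered z)      ≡⟨ ∑-distrib-+ (indicator ∘ (y ==_)) lowered ⟩
    sum (indicator ∘ (y ==_)) + capacity c′ Z       ≡⟨ cong (_+ capacity c′ Z) (∑-δ y 1) ⟩
    suc (capacity c′ Z)                             ∎
    where
    open ≤-Reasoning
    c′ : Fin v → ℕ
    c′ z = c z ∸ indicator (y == z)
    lowered : Fin v → ℕ
    lowered z = if neighbours Z z then c′ z else 0
    pointwise : ∀ z → (if neighbours Z z then c z else 0) ≤ indicator (y == z) + lowered z
    pointwise z with neighbours Z z
    ... | true  = m≤n+m∸n (c z) (indicator (y == z))
    ... | false = z≤n

  -- Halmos–Vaughan: split L along a tight proper subset if there is one; otherwise every proper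
  -- subset has slack, so any edge xy with c y > 0 can be fixed and c y lowered by one.
  Tight : (Fin v → Bool) → (Fin v → ℕ) → (Fin v → Bool) → Set
  Tight L c X = X ⊆ L × 0 < countFin X × countFin X < countFin L × capacity c X ≤ countFin X

  tight? : (L : Fin v → Bool) (c : Fin v → ℕ) → Decidable (Tight L c)
  tight? L c X = Fin.all? (λ x → T? (X x) →-dec T? (L x))
          ×-dec 0 <? countFin X ×-dec countFin X <? countFin L ×-dec capacity c X ≤? countFin X

  tight-resp : {L : Fin v → Bool} {c : Fin v → ℕ} {X Y : Fin v → Bool} → X ≗ Y → Tight L c X → Tight L c Y
  tight-resp {L} {c} {X} {Y} X≗Y (X⊆L , X>0 , X<L , capX≤X) =
      (λ x → X⊆L x ∘ subst T (sym (X≗Y x)))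
    , subst (0 <_) X≡Y X>0
    , subst (_< countFin L) X≡Y X<L
    , subst₂ _≤_ (capacity-cong c X≗Y) X≡Y capX≤X
    where
    X≡Y : countFin X ≡ countFin Y
    X≡Y = count-cong X≗Y

  Recursion : (Fin v → Bool) → Set
  Recursion L = ∀ L′ c′ → countFin L′ < countFin L → HallCondition L′ c′ → Assignment L′ c′

  from-tight : {L : Fin v → Bool} {c : Fin v → ℕ} → Recursion L → HallCondition L c →
               ∀ X → Tight L c X → Assignment L c
  from-tight {L} {c} recurse hall-L X (X⊆L , X>0 , X<L , capX≤X) =
    weaken (merge (restrict inside) outside) L⊆X∨rest capacity-split
    where
    rest : Fin v → Bool
    rest x = L x ∧ not (X x)
    c-rest : Fin v → ℕ
    c-rest y = if neighbours X y then 0 else c y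

    inside : Assignment X c
    inside = recurse X c X<L λ Z Z⊆X → hall-L Z λ x → X⊆L x ∘ Z⊆X x

    rest<L : countFin rest < countFin L
    rest<L with count-witness X X>0
    ... | x , Xx = count-remove< L X x (X⊆L x Xx) Xx

    hall-rest : HallCondition rest c-rest
    hall-rest Z Z⊆rest = +-cancelʳ-≤ (countFin X) _ _ (begin
      countFin Z + countFin X                 ≡⟨ count-∨-disjoint Z X disjoint ⟨
      countFin (λ x → Z x ∨ X x)              ≤⟨ hall-L _ Z∨X⊆L ⟩
      capacity c (λ x → Z x ∨ X x)            ≤⟨ capacity-∨ c Z X ⟩
      capacity c-rest Z + capacity c X        ≤⟨ +-monoʳ-≤ _ capX≤X ⟩
      capacity c-rest Z + countFin X          ∎)
      where
      open ≤-Reasoning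
      disjoint : ∀ x → T (Z x) → ¬ T (X x)
      disjoint x Zx Xx with X x | T-∧⁻ {L x} (Z⊆rest x Zx)
      ... | true | _ , ()
      Z∨X⊆L : (λ x → Z x ∨ X x) ⊆ L
      Z∨X⊆L x ZXx with Z x in e
      ... | true  = proj₁ (T-∧⁻ (Z⊆rest x (subst T (sym e) tt)))
      ... | false = X⊆L x ZXx

    outside : Assignment rest c-rest
    outside = recurse rest c-rest rest<L hall-rest

    L⊆X∨rest : L ⊆ λ x → X x ∨ rest x
    L⊆X∨rest x Lx with X x
    ... | true  = tt
    ... | false = T-∧⁺ Lx tt

    capacity-split : ∀ y → (if neighbours X y then c y else 0) + c-rest y ≤ c y
    capacity-split y with neighbours X y
    ... | true  = ≤-reflexive (+-identityʳ (c y))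
    ... | false = ≤-refl

  from-slack : {L : Fin v → Bool} {c : Fin v → ℕ} → Recursion L → HallCondition L c →
               (∀ X → ¬ Tight L c X) → ∀ x → T (L x) → Assignment L c
  from-slack {L} {c} recurse hall-L slack x Lx =
    weaken (merge (assign-singleton Axy) outside) L⊆x∨rest capacity-split
    where
    target : ∃ λ y → 0 < (if neighbours (_== x) y then c y else 0)
    target = sum-pos _ (≤-trans (≤-reflexive (sym (count-== x)))
                                (hall-L (_== x) λ u u=x → subst (T ∘ L) (sym (==⇒≡ u=x)) Lx))
    y : Fin v
    y = proj₁ target
    y-ok : T (neighbours (_== x) y) × 0 < c y
    y-ok with neighbours (_== x) y | proj₂ target
    ... | true | cy>0 = tt , cy>0
    Axy : T (A x y)
    Axy with neighbours⁻ (proj₁ y-ok)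
    ... | u , u=x , Auy = subst (λ u → T (A u y)) (==⇒≡ u=x) Auy

    rest : Fin v → Bool
    rest u = L u ∧ not (u == x)
    c-rest : Fin v → ℕ
    c-rest z = c z ∸ indicator (y == z)

    hall-rest : HallCondition rest c-rest
    hall-rest Z Z⊆rest with countFin Z in eZ
    ... | zero  = z≤n
    ... | suc k = ≤-pred (≤-trans (subst (_< capacity c Z) eZ Z<capZ) (capacity-∸ c y Z))
      where
      Z⊆L : Z ⊆ L
      Z⊆L u = proj₁ ∘ T-∧⁻ ∘ Z⊆rest u
      Z<L : countFin Z < countFin L
      Z<L = ≤-<-trans (count-mono Z⊆rest) (count-remove< L (_== x) x Lx (==-refl x))
      Z<capZ : countFin Z < capacity c Z
      Z<capZ = ≰⇒> λ capZ≤Z → slack Z (Z⊆L , subst (0 <_) (sym eZ) (s≤s z≤n) , Z<L , capZ≤Z)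

    outside : Assignment rest c-rest
    outside = recurse rest c-rest (count-remove< L (_== x) x Lx (==-refl x)) hall-rest

    L⊆x∨rest : L ⊆ λ u → (u == x) ∨ rest u
    L⊆x∨rest u Lu with u == x
    ... | true  = tt
    ... | false = T-∧⁺ Lu tt

    capacity-split : ∀ z → indicator (y == z) + c-rest z ≤ c z
    capacity-split z with y ≟ z
    ... | yes refl = ≤-reflexive (m+[n∸m]≡n (proj₂ y-ok))
    ... | no  _    = ≤-refl

  hall-bounded : ∀ k L c → countFin L ≤ k → HallCondition L c → Assignment L c
  hall-bounded zero    L c L≤0 _ = assign-empty c (n≤0⇒n≡0 L≤0)
  hall-bounded (suc k) L c L≤k hall-L = by-cases (Fin.any? (T? ∘ L)) (any-subset? tight-resp (tight? L c))
    where
    recurse : Recursion L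
    recurse L′ c′ L′<L = hall-bounded k L′ c′ (≤-pred (≤-trans L′<L L≤k))
    by-cases : Dec (∃ λ x → T (L x)) → Dec (∃ (Tight L c)) → Assignment L c
    by-cases (no empty)     _                 = assign-empty c (count≡0 L λ x Lx → empty (x , Lx))
    by-cases (yes _)        (yes (X , tight)) = from-tight recurse hall-L X tight
    by-cases (yes (x , Lx)) (no no-tight)     = from-slack recurse hall-L (λ X tight → no-tight (X , tight)) x Lx

  hall : ∀ L c → HallCondition L c → Assignment L c
  hall L c = hall-bounded v L c (count≤size L)

-- From a choice of neighbours to a star factor

fibre : (Fin v → Fin v) → Fin v → ℕ
fibre = load (λ _ → true)

reciprocal : (Fin v → Fin v) → Fin v → Bool
reciprocal p x = p (p x) == x

redirect : (Fin v → Fin v) → Fin v → Fin v → Fin v → Fin v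
redirect p w x u = if u == w then x else p u

redirect-≢ : (p : Fin v → Fin v) {w u : Fin v} (x : Fin v) → u ≢ w → redirect p w x u ≡ p u
redirect-≢ p {w} {u} x u≢w with u ≟ w
... | yes u≡w = ⊥-elim (u≢w u≡w)
... | no  _   = refl

redirect-≡ : (p : Fin v → Fin v) (w x : Fin v) → redirect p w x w ≡ x
redirect-≡ p w x with w ≟ w
... | yes _   = refl
... | no  w≢w = ⊥-elim (w≢w refl)

fibre-redirect : (p : Fin v → Fin v) (w x t : Fin v) → fibre (redirect p w x) t ≤ fibre p t + indicator (x == t)
fibre-redirect p w x t = begin
  fibre (redirect p w x) t                                         ≤⟨ count-mono by-case ⟩
  countFin (λ u → (p u == t) ∨ ((u == w) ∧ (x == t)))               ≤⟨ count-∨ (λ u → p u == t) _ ⟩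
  fibre p t + countFin (λ u → (u == w) ∧ (x == t))                  ≡⟨ cong (fibre p t +_) (count-==-∧ w (x == t)) ⟩
  fibre p t + indicator (x == t)                                   ∎
  where
  open ≤-Reasoning
  by-case : (λ u → redirect p w x u == t) ⊆ (λ u → (p u == t) ∨ ((u == w) ∧ (x == t)))
  by-case u h with u == w
  ... | true  = T-∨⁺ʳ (p u == t) h
  ... | false = T-∨⁺ˡ h

module _ (p : Fin v → Fin v) {w x : Fin v} (px≡w : p x ≡ w) (x≢w : x ≢ w) where

  reciprocal-redirect : T (reciprocal (redirect p w x) w)
  reciprocal-redirect = ≡⇒== (begin
    redirect p w x (redirect p w x w)  ≡⟨ cong (redirect p w x) (redirect-≡ p w x) ⟩
    redirect p w x x                   ≡⟨ redirect-≢ p x x≢w ⟩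
    p x                                ≡⟨ px≡w ⟩
    w                                  ∎)
    where open ≡-Reasoning

  reciprocal-redirect-⊆ : p (p w) ≢ w → reciprocal p ⊆ reciprocal (redirect p w x)
  reciprocal-redirect-⊆ ppw≢w t rec = ≡⇒== (begin
    redirect p w x (redirect p w x t)  ≡⟨ cong (redirect p w x) (redirect-≢ p x t≢w) ⟩
    redirect p w x (p t)               ≡⟨ redirect-≢ p x pt≢w ⟩
    p (p t)                            ≡⟨ ppt≡t ⟩
    t                                  ∎)
    where
    open ≡-Reasoning
    ppt≡t : p (p t) ≡ t
    ppt≡t = ==⇒≡ rec
    t≢w : t ≢ w
    t≢w refl = ppw≢w ppt≡t
    pt≢w : p t ≢ w
    pt≢w pt≡w = ppw≢w (begin
      p (p w)      ≡⟨ cong (p ∘ p) pt≡w ⟨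
      p (p (p t))  ≡⟨ cong p ppt≡t ⟩
      p t          ≡⟨ pt≡w ⟩
      w            ∎)

m*n≤n⇒n≡0 : {m n : ℕ} → 2 ≤ m → m * n ≤ n → n ≡ 0
m*n≤n⇒n≡0 {m} {zero}  _   _     = refl
m*n≤n⇒n≡0 {m} {suc n} 2≤m mn≤n = ⊥-elim (<⇒≱ (<-≤-trans (m<m+n (suc n) z<s) (*-monoˡ-≤ (suc n) 2≤m)) mn≤n)

module StarFactorFromChoice {v : ℕ} (H : Graph v) (m : ℕ) where

  open HallWithCapacities (adj H) using (Assignment)
  open Assignment

  Choice : Set
  Choice = Assignment (λ _ → true) (λ _ → m)

  Bad : (Fin v → Fin v) → Fin v → Set
  Bad p w = m ≤ fibre p w × p (p w) ≢ w

  bad? : (p : Fin v → Fin v) → Decidable (Bad p)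
  bad? p w = m ≤? fibre p w ×-dec ¬? (p (p w) ≟ w)

  Improvable : (Fin v → Fin v) → Fin v → Set
  Improvable p x = Bad p (p x) × fibre p x < m

  improvable? : (p : Fin v → Fin v) → Decidable (Improvable p)
  improvable? p x = bad? p (p x) ×-dec fibre p x <? m

  improve-step : (a : Choice) (x : Fin v) → Improvable (choice a) x →
                 ∃ λ (a′ : Choice) → countFin (reciprocal (choice a)) < countFin (reciprocal (choice a′))
  improve-step a x ((_ , ppw≢w) , fx<m) =
    a′ , count-< w (reciprocal-redirect-⊆ p refl x≢w ppw≢w) (reciprocal-redirect p refl x≢w) (ppw≢w ∘ ==⇒≡)
    where
    p : Fin v → Fin v
    p = choice a
    w : Fin v
    w = p x
    x≢w : x ≢ w
    x≢w x≡w = subst T (irrefl H x) (subst (T ∘ adj H x) (sym x≡w) (adjacent a x tt))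
    adjacent′ : ∀ u → T (adj H u (redirect p w x u))
    adjacent′ u with u ≟ w
    ... | yes refl = subst T (adj-sym H x w) (adjacent a x tt)
    ... | no  _    = adjacent a u tt
    fibre′≤ : ∀ t → fibre (redirect p w x) t ≤ m
    fibre′≤ t with x ≟ t | fibre-redirect p w x t
    ... | yes refl | bound = ≤-trans bound (subst (_≤ m) (+-comm 1 (fibre p x)) fx<m)
    ... | no  _    | bound = ≤-trans bound (≤-trans (≤-reflexive (+-identityʳ _)) (load≤ a t))
    a′ : Choice
    a′ = record { choice = redirect p w x ; adjacent = λ u _ → adjacent′ u ; load≤ = fibre′≤ }

  no-bad : 2 ≤ m → (a : Choice) → (∀ x → ¬ Improvable (choice a) x) → ∀ w → ¬ Bad (choice a) w
  no-bad 2≤m a stuck w₀ bad-w₀ = <-irrefl (sym (m*n≤n⇒n≡0 2≤m m*R≤R)) (count-pos R w₀ (fromWitness bad-w₀))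
    where
    p : Fin v → Fin v
    p = choice a
    R : Fin v → Bool
    R w = ⌊ bad? p w ⌋
    closed : ∀ {w x} → Bad p w → p x ≡ w → Bad p x
    closed {w} {x} bad-w px≡w = fx≥m , ppx≢x
      where
      fx≥m : m ≤ fibre p x
      fx≥m = ≮⇒≥ λ fx<m → stuck x (subst (Bad p) (sym px≡w) bad-w , fx<m)
      ppx≢x : p (p x) ≢ x
      ppx≢x ppx≡x = proj₂ bad-w (trans (cong (p ∘ p) (sym px≡w)) (trans (cong p ppx≡x) px≡w))
    weighted : ∀ w → m * indicator (R w) ≤ load R p w
    weighted w with bad? p w
    ... | no  _     = ≤-trans (≤-reflexive (*-zeroʳ m)) z≤n
    ... | yes bad-w = begin
      m * 1         ≡⟨ *-identityʳ m ⟩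
      m             ≤⟨ proj₁ bad-w ⟩
      fibre p w     ≤⟨ count-mono preimage⊆R ⟩
      load R p w    ∎
      where
      open ≤-Reasoning
      preimage⊆R : ∀ x → T (true ∧ (p x == w)) → T (R x ∧ (p x == w))
      preimage⊆R x px=w = T-∧⁺ (fromWitness (closed bad-w (==⇒≡ px=w))) px=w
    m*R≤R : m * countFin R ≤ countFin R
    m*R≤R = begin
      m * countFin R                        ≡⟨ cong (m *_) (count≡sum R) ⟩
      m * sum (indicator ∘ R)               ≡⟨ *-distribˡ-sum m (indicator ∘ R) ⟩
      sum (λ w → m * indicator (R w))       ≤⟨ sum-mono weighted ⟩
      sum (load R p)                        ≡⟨ ∑-load R p ⟩
      countFin R                            ∎
      where open ≤-Reasoning

  factor-of-choice : (a : Choice) → (∀ w → ¬ Bad (choice a) w) → StarFactor H m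
  factor-of-choice a good = record
    { hadj     = edge
    ; hsym     = λ x y → ∨-comm (p x == y) (p y == x)
    ; hsub     = λ x y e → Equivalence.to T-≡ (edge⇒adj x y (Equivalence.from T-≡ e))
    ; degLower = λ x → count-pos (edge x) (p x) (T-∨⁺ˡ {b = p (p x) == x} (==-refl (p x)))
    ; degUpper = degree≤
    }
    where
    p : Fin v → Fin v
    p = choice a
    edge : Fin v → Fin v → Bool
    edge x y = (p x == y) ∨ (p y == x)
    edge⇒adj : ∀ x y → T (edge x y) → T (adj H x y)
    edge⇒adj x y e with p x ≟ y | p y ≟ x
    ... | yes refl | _        = adjacent a x tt
    ... | no  _    | yes refl = subst T (adj-sym H y x) (adjacent a y tt)
    degree≤ : ∀ x → countFin (edge x) ≤ m
    degree≤ x with fibre p x <? m | p (p x) ≟ x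
    ... | yes fx<m | _        = begin
      countFin (edge x)                          ≤⟨ count-∨ (p x ==_) (λ y → p y == x) ⟩
      countFin (p x ==_) + fibre p x             ≡⟨ cong (_+ fibre p x) (trans (count-cong (==-sym (p x))) (count-== (p x))) ⟩
      suc (fibre p x)                            ≤⟨ fx<m ⟩
      m                                          ∎
      where open ≤-Reasoning
    ... | no fx≮m  | yes ppx≡x = ≤-trans (count-mono edge⊆preimage) (load≤ a x)
      where
      edge⊆preimage : ∀ y → T (edge x y) → T (p y == x)
      edge⊆preimage y e with p x ≟ y
      ... | yes refl = ≡⇒== ppx≡x
      ... | no  _    = e
    ... | no fx≮m  | no ppx≢x = ⊥-elim (good x (≮⇒≥ fx≮m , ppx≢x))

  star-factor : 2 ≤ m → Choice → StarFactor H m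
  star-factor 2≤m a₀ = improve a₀ (<-wellFounded _)
    where
    improve : (a : Choice) → Acc _<_ (v ∸ countFin (reciprocal (choice a))) → StarFactor H m
    improve a (acc smaller) with Fin.any? (improvable? (choice a))
    ... | yes (x , imp) = let a′ , grows = improve-step a x imp
                          in improve a′ (smaller (∸-monoʳ-< grows (count≤size (reciprocal (choice a′)))))
    ... | no  stuck     = factor-of-choice a (no-bad 2≤m a λ x imp → stuck (x , imp))

-- Isolated vertices and star factors

module _ {v : ℕ} (H : Graph v) where

  isolated⁻ : {S : VSet v} {x : Fin v} → T (isolatedIn H S x) →
              ¬ T (S x) × (∀ y → T (adj H x y) → T (S y))
  isolated⁻ {S} {x} iso-x with S x
  ... | false = (λ ()) , λ y → T-not-∨⁻ (allFin⁻ iso-x y)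

  isolated⁺ : {S : VSet v} {x : Fin v} → ¬ T (S x) → (∀ y → T (adj H x y) → T (S y)) →
              T (isolatedIn H S x)
  isolated⁺ {S} {x} x∉S N⊆S with S x
  ... | true  = x∉S tt
  ... | false = allFin⁺ λ y → T-not-∨⁺ (N⊆S y)

  iso-cong : {S S′ : VSet v} → S ≗ S′ → iso H S ≡ iso H S′
  iso-cong S≗S′ = count-cong λ x →
    cong₂ (λ a b → not a ∧ b) (S≗S′ x) (allFin-cong λ y → cong (not (adj H x y) ∨_) (S≗S′ y))

module _ {v : ℕ} (H : Graph v) where

  open HallWithCapacities (adj H) using (neighbours; neighbours⁺; neighbours⁻; capacity; hall)

  capacity-const : (m : ℕ) (X : VSet v) → capacity (λ _ → m) X ≡ m * countFin (neighbours X)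
  capacity-const m X = begin
    sum (λ y → if neighbours X y then m else 0)     ≡⟨ sum-cong-≗ (λ y → scale (neighbours X y)) ⟨
    sum (λ y → m * indicator (neighbours X y))      ≡⟨ *-distribˡ-sum m (indicator ∘ neighbours X) ⟨
    m * sum (indicator ∘ neighbours X)              ≡⟨ cong (m *_) (count≡sum (neighbours X)) ⟨
    m * countFin (neighbours X)                     ∎
    where
    open ≡-Reasoning
    scale : ∀ b → m * indicator b ≡ (if b then m else 0)
    scale true  = *-identityʳ m
    scale false = *-zeroʳ m

  hall-condition : {m : ℕ} → 1 ≤ m → (∀ S → iso H S ≤ m * card S) →
                   ∀ X → countFin X ≤ m * countFin (neighbours X)
  hall-condition {m} 1≤m iso≤ X = begin
    countFin X                                              ≡⟨ count-split X N ⟩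
    countFin (λ x → X x ∧ N x) + countFin (λ x → X x ∧ not (N x))
      ≤⟨ +-mono-≤ (≤-trans (≤-reflexive (count-cong λ x → ∧-comm (X x) (N x))) (m≤m*c _))
                  (≤-trans (count-mono outside-isolated) (iso≤ S₀)) ⟩
    m * countFin (λ y → N y ∧ X y) + m * countFin S₀        ≡⟨ *-distribˡ-+ m _ _ ⟨
    m * (countFin (λ y → N y ∧ X y) + countFin S₀)          ≡⟨ cong (m *_) (count-split N X) ⟨
    m * countFin N                                          ∎
    where
    open ≤-Reasoning
    N : VSet v
    N = neighbours X
    S₀ : VSet v
    S₀ y = N y ∧ not (X y)
    m≤m*c : ∀ c → c ≤ m * c
    m≤m*c c = ≤-trans (≤-reflexive (sym (*-identityˡ c))) (*-monoˡ-≤ c 1≤m)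
    outside-isolated : (λ x → X x ∧ not (N x)) ⊆ isolatedIn H S₀
    outside-isolated x X∧¬N = isolated⁺ H (¬Nx ∘ proj₁ ∘ T-∧⁻) neighbour∈S₀
      where
      Xx : T (X x)
      Xx = proj₁ (T-∧⁻ X∧¬N)
      ¬Nx : ¬ T (N x)
      ¬Nx = T-not⁻ (proj₂ (T-∧⁻ {X x} X∧¬N))
      neighbour∈S₀ : ∀ y → T (adj H x y) → T (S₀ y)
      neighbour∈S₀ y Axy =
        T-∧⁺ (neighbours⁺ Xx Axy) (T-not⁺ λ Xy → ¬Nx (neighbours⁺ Xy (subst T (adj-sym H x y) Axy)))

  star-factor-criterion : {m : ℕ} → 2 ≤ m → (∀ S → iso H S ≤ m * card S) → StarFactor H m
  star-factor-criterion {m} 2≤m iso≤ = star-factor 2≤m (hall (λ _ → true) (λ _ → m) condition)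
    where
    open StarFactorFromChoice H m using (star-factor)
    condition : ∀ X → X ⊆ (λ _ → true) → countFin X ≤ capacity (λ _ → m) X
    condition X _ = ≤-trans (hall-condition (≤-trans (s≤s z≤n) 2≤m) iso≤ X) (≤-reflexive (sym (capacity-const m X)))

-- Deleting edges

module _ {v : ℕ} {G : Graph v} (E : EdgeSubset G) where

  edgeDegree : Fin v → ℕ
  edgeDegree x = countFin (mem E x)

  forward : Fin v → ℕ
  forward x = countFin λ y → (toℕ x <ᵇ toℕ y) ∧ mem E x y

  backward : Fin v → ℕ
  backward x = countFin λ y → (toℕ y <ᵇ toℕ x) ∧ mem E x y

  mem-irrefl : ∀ x → ¬ T (mem E x x)
  mem-irrefl x Exx = subst T (irrefl G x) (Equivalence.from T-≡ (memSub E x x (Equivalence.to T-≡ Exx)))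

  edgeDegree-split : ∀ x → edgeDegree x ≡ forward x + backward x
  edgeDegree-split x = trans (count-split (mem E x) (λ y → toℕ x <ᵇ toℕ y))
                             (cong₂ _+_ (count-cong λ y → ∧-comm (mem E x y) _) (count-cong by-order))
    where
    by-order : ∀ y → (mem E x y ∧ not (toℕ x <ᵇ toℕ y)) ≡ ((toℕ y <ᵇ toℕ x) ∧ mem E x y)
    by-order y with mem E x y in Exy | toℕ x <ᵇ toℕ y in x<y | toℕ y <ᵇ toℕ x in y<x
    ... | false | _     | false = refl
    ... | false | _     | true  = refl
    ... | true  | true  | false = refl
    ... | true  | false | true  = refl
    ... | true  | true  | true  =
      ⊥-elim (<-asym (<ᵇ⇒< (toℕ x) (toℕ y) (subst T (sym x<y) tt)) (<ᵇ⇒< (toℕ y) (toℕ x) (subst T (sym y<x) tt)))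
    ... | true  | false | false = ⊥-elim (mem-irrefl x (subst (T ∘ mem E x) (sym x≡y) (subst T (sym Exy) tt)))
      where
      x≡y : x ≡ y
      x≡y = Fin.toℕ-injective (≤-antisym (≮⇒≥ (λ y<x′ → subst T y<x (<⇒<ᵇ {toℕ y} y<x′)))
                                          (≮⇒≥ (λ x<y′ → subst T x<y (<⇒<ᵇ {toℕ x} x<y′))))

  ∑backward≡∑forward : sum backward ≡ sum forward
  ∑backward≡∑forward = begin
    sum (λ x → countFin λ y → (toℕ y <ᵇ toℕ x) ∧ mem E x y)
      ≡⟨ sum-cong-≗ (λ x → count≡sum (λ y → (toℕ y <ᵇ toℕ x) ∧ mem E x y)) ⟩
    sum (λ x → sum λ y → indicator ((toℕ y <ᵇ toℕ x) ∧ mem E x y))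
      ≡⟨ ∑-comm (λ x y → indicator ((toℕ y <ᵇ toℕ x) ∧ mem E x y)) ⟩
    sum (λ y → sum λ x → indicator ((toℕ y <ᵇ toℕ x) ∧ mem E x y))
      ≡⟨ sum-cong-≗ (λ y → sum-cong-≗ λ x → cong (λ b → indicator ((toℕ y <ᵇ toℕ x) ∧ b)) (memSym E x y)) ⟩
    sum (λ y → sum λ x → indicator ((toℕ y <ᵇ toℕ x) ∧ mem E y x))
      ≡⟨ sum-cong-≗ (λ y → count≡sum (λ x → (toℕ y <ᵇ toℕ x) ∧ mem E y x)) ⟨
    sum forward
      ∎
    where open ≡-Reasoning

  handshake : sum edgeDegree ≡ 2 * edgeCount E
  handshake = begin
    sum edgeDegree                        ≡⟨ sum-cong-≗ edgeDegree-split ⟩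
    sum (λ x → forward x + backward x)    ≡⟨ ∑-distrib-+ forward backward ⟩
    sum forward + sum backward            ≡⟨ cong (sum forward +_) ∑backward≡∑forward ⟩
    sum forward + sum forward             ≡⟨ cong (sum forward +_) (+-identityʳ (sum forward)) ⟨
    2 * sum forward                       ≡⟨ cong (2 *_) (sumFin≡sum forward) ⟨
    2 * edgeCount E                       ∎
    where open ≡-Reasoning

  edgeDegree≤edgeCount : ∀ x → edgeDegree x ≤ edgeCount E
  edgeDegree≤edgeCount x = begin
    edgeDegree x                                ≡⟨ edgeDegree-split x ⟩
    forward x + backward x                      ≡⟨ cong₂ _+_ (sym (∑-δ x (forward x))) (count≡sum (λ z → (toℕ z <ᵇ toℕ x) ∧ mem E x z)) ⟩
    sum at-x + sum earlier                      ≡⟨ ∑-distrib-+ at-x earlier ⟨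
    sum (λ z → at-x z + earlier z)              ≤⟨ sum-mono pointwise ⟩
    sum forward                                 ≡⟨ sumFin≡sum forward ⟨
    edgeCount E                                 ∎
    where
    open ≤-Reasoning
    at-x : Fin v → ℕ
    at-x z = if x == z then forward x else 0
    earlier : Fin v → ℕ
    earlier z = indicator ((toℕ z <ᵇ toℕ x) ∧ mem E x z)
    pointwise : ∀ z → at-x z + earlier z ≤ forward z
    pointwise z with x ≟ z | toℕ z <ᵇ toℕ x in z<x | mem E x z in Exz
    ... | yes refl | true  | _     = ⊥-elim (<-irrefl refl (<ᵇ⇒< (toℕ x) (toℕ x) (subst T (sym z<x) tt)))
    ... | yes refl | false | _     = ≤-reflexive (+-identityʳ (forward x))
    ... | no  _    | false | _     = z≤n
    ... | no  _    | true  | false = z≤n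
    ... | no  _    | true  | true  =
      count-pos _ x (T-∧⁺ (subst T (sym z<x) tt) (subst T (sym (trans (memSym E z x) Exz)) tt))

  isolated-deleteEdges : {S : VSet v} {x : Fin v} → T (isolatedIn (deleteEdges G E) S x) →
                         T (isolatedIn G S x) ⊎ 0 < edgeDegree x
  isolated-deleteEdges {S} {x} iso′ with Fin.any? (λ y → T? (mem E x y))
  ... | yes (y , Exy) = inj₂ (count-pos (mem E x) y Exy)
  ... | no  none      = inj₁ (isolated⁺ G x∉S λ y Axy → N⊆S y (T-∧⁺ Axy (T-not⁺ λ Exy → none (y , Exy))))
    where
    x∉S : ¬ T (S x)
    x∉S = proj₁ (isolated⁻ (deleteEdges G E) iso′)
    N⊆S : ∀ y → T (adj (deleteEdges G E) x y) → T (S y)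
    N⊆S = proj₂ (isolated⁻ (deleteEdges G E) iso′)

  degree-isolated : {S : VSet v} {x : Fin v} → T (isolatedIn (deleteEdges G E) S x) →
                    degree G x ≤ card S + edgeDegree x
  degree-isolated {S} {x} iso′ = ≤-trans (count-mono covered) (count-∨ S (mem E x))
    where
    N⊆S : ∀ y → T (adj (deleteEdges G E) x y) → T (S y)
    N⊆S = proj₂ (isolated⁻ (deleteEdges G E) iso′)
    covered : ∀ y → T (adj G x y) → T (S y ∨ mem E x y)
    covered y Axy with mem E x y in Exy
    ... | true  = T-∨⁺ʳ (S y) tt
    ... | false = T-∨⁺ˡ (N⊆S y (T-∧⁺ Axy (subst (T ∘ not) (sym Exy) tt)))

  iso-deleteEdges : (S : VSet v) → iso (deleteEdges G E) S ≤ iso G S + 2 * edgeCount E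
  iso-deleteEdges S = begin
    iso (deleteEdges G E) S                                         ≡⟨ count≡sum (isolatedIn (deleteEdges G E) S) ⟩
    sum (indicator ∘ isolatedIn (deleteEdges G E) S)                ≤⟨ sum-mono pointwise ⟩
    sum (λ x → indicator (isolatedIn G S x) + edgeDegree x)         ≡⟨ ∑-distrib-+ (indicator ∘ isolatedIn G S) edgeDegree ⟩
    sum (indicator ∘ isolatedIn G S) + sum edgeDegree               ≡⟨ cong₂ _+_ (sym (count≡sum (isolatedIn G S))) handshake ⟩
    iso G S + 2 * edgeCount E                                       ∎
    where
    open ≤-Reasoning
    pointwise : ∀ x → indicator (isolatedIn (deleteEdges G E) S x) ≤ indicator (isolatedIn G S x) + edgeDegree x
    pointwise x with isolatedIn (deleteEdges G E) S x in iso′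
    ... | false = z≤n
    ... | true with isolated-deleteEdges {S} {x} (subst T (sym iso′) tt)
    ...   | inj₁ iso-x = ≤-trans (≤-reflexive (sym (indicator-true iso-x))) (m≤m+n _ _)
    ...   | inj₂ pos   = ≤-trans pos (m≤n+m _ _)

-- Isolated toughness

1/q≤c/k⇒k≤c*q : ∀ q k c → ℤ.+ 1 / suc q ≤ℚ ℤ.+ c / suc k → suc k ≤ c * suc q
1/q≤c/k⇒k≤c*q q k c le
  with ℚᵘ.≤-respˡ-≃ (ℚ.toℚᵘ-fromℚᵘ (ℚᵘ.mkℚᵘ (ℤ.+ 1) q))
         (ℚᵘ.≤-respʳ-≃ (ℚ.toℚᵘ-fromℚᵘ (ℚᵘ.mkℚᵘ (ℤ.+ c) k)) (ℚ.toℚᵘ-mono-≤ le))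
... | ℚᵘ.*≤* cross = subst (_≤ c * suc q) (*-identityˡ (suc k))
        (ℤ.drop‿+≤+ (subst₂ ℤ._≤_ (sym (ℤ.pos-* 1 (suc k))) (sym (ℤ.pos-* c (suc q))) cross))

fraction : ℕ → ℕ → ℚ
fraction c zero    = 0ℚ
fraction c (suc k) = ℤ.+ c / suc k

module _ {v : ℕ} (G : Graph v) where

  ratio≡fraction : (S : VSet v) → ratio G S ≡ fraction (card S) (iso G S)
  ratio≡fraction S with iso G S
  ... | zero  = refl
  ... | suc k = refl

  ratio-cong : {S S′ : VSet v} → S ≗ S′ → ratio G S ≡ ratio G S′
  ratio-cong {S} {S′} S≗S′ = begin
    ratio G S                          ≡⟨ ratio≡fraction S ⟩
    fraction (card S) (iso G S)        ≡⟨ cong₂ fraction (count-cong S≗S′) (iso-cong G S≗S′) ⟩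
    fraction (card S′) (iso G S′)      ≡⟨ ratio≡fraction S′ ⟨
    ratio G S′                         ∎
    where open ≡-Reasoning

  two-isolated⇒¬complete : (S : VSet v) → 2 ≤ iso G S → ¬ IsComplete G
  two-isolated⇒¬complete S 2≤iso complete = <⇒≱ 2≤iso (count≤1 (isolatedIn G S) unique)
    where
    unique : ∀ a b → T (isolatedIn G S a) → T (isolatedIn G S b) → a ≡ b
    unique a b iso-a iso-b with a ≟ b
    ... | yes a≡b = a≡b
    ... | no  a≢b = ⊥-elim (proj₁ (isolated⁻ G iso-b)
                      (proj₂ (isolated⁻ G iso-a) b (Equivalence.from T-≡ (complete a b a≢b))))

  isolated-toughness-bound : (q : ℕ) → (∀ r → IsIsolatedToughness G r → recip (suc q) ≤ℚ r) →
                             ∀ S → 2 ≤ iso G S → iso G S ≤ suc q * card S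
  isolated-toughness-bound q tough S 2≤iso =
    from-fraction (iso G S) 2≤iso (subst (recip (suc q) ≤ℚ_) (ratio≡fraction S)
      (ℚ.≤-trans (tough (ratio G S₀) I[G]≡ratio[S₀]) (minimal S 2≤iso)))
    where
    minimum : ∃ λ S₀ → 2 ≤ iso G S₀ × (∀ S′ → 2 ≤ iso G S′ → ratio G S₀ ≤ℚ ratio G S′)
    minimum = argmin-subset (subst (2 ≤_) ∘ iso-cong G) (λ S → 2 ≤? iso G S)
                (DecTotalOrder.totalOrder ℚ.≤-decTotalOrder) (ratio G) ratio-cong (S , 2≤iso)
    S₀ : VSet v
    S₀ = proj₁ minimum
    minimal : ∀ S′ → 2 ≤ iso G S′ → ratio G S₀ ≤ℚ ratio G S′
    minimal = proj₂ (proj₂ minimum)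
    I[G]≡ratio[S₀] : IsIsolatedToughness G (ratio G S₀)
    I[G]≡ratio[S₀] = (λ complete → ⊥-elim (two-isolated⇒¬complete S 2≤iso complete))
                   , λ _ → (S₀ , proj₁ (proj₂ minimum) , refl) , minimal
    from-fraction : ∀ i → 2 ≤ i → recip (suc q) ≤ℚ fraction (card S) i → i ≤ suc q * card S
    from-fraction (suc k) _ le = subst (suc k ≤_) (*-comm (card S) (suc q)) (1/q≤c/k⇒k≤c*q q k (card S) le)

2n≤m⇒2≤m : {m n : ℕ} → 1 ≤ n → 2 * n ≤ m → 2 ≤ m
2n≤m⇒2≤m 1≤n 2n≤m = ≤-trans (*-monoʳ-≤ 2 1≤n) 2n≤m

module _ {m n : ℕ} (n≤m : n ≤ m) {s : ℕ} (2≤s : 2 ≤ s) where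

  [m∸n]*s+2*n≤m*s : (m ∸ n) * s + 2 * n ≤ m * s
  [m∸n]*s+2*n≤m*s = begin
    (m ∸ n) * s + 2 * n    ≤⟨ +-monoʳ-≤ ((m ∸ n) * s) (≤-trans (≤-reflexive (*-comm 2 n)) (*-monoʳ-≤ n 2≤s)) ⟩
    (m ∸ n) * s + n * s    ≡⟨ *-distribʳ-+ s (m ∸ n) n ⟨
    (m ∸ n + n) * s        ≡⟨ cong (_* s) (m∸n+n≡m n≤m) ⟩
    m * s                  ∎
    where open ≤-Reasoning

1+2*n≤m*s : {m n s : ℕ} → 1 ≤ n → 2 * n ≤ m → 2 ≤ s → 1 + 2 * n ≤ m * s
1+2*n≤m*s {m} {n} {s} 1≤n 2n≤m 2≤s = begin
  1 + 2 * n    ≤⟨ +-monoˡ-≤ (2 * n) (≤-trans 1≤n (m≤m+n n (n + 0))) ⟩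
  2 * n + 2 * n ≤⟨ +-mono-≤ 2n≤m 2n≤m ⟩
  m + m        ≡⟨ cong (m +_) (+-identityʳ m) ⟨
  2 * m        ≤⟨ *-monoˡ-≤ m 2≤s ⟩
  s * m        ≡⟨ *-comm s m ⟩
  m * s        ∎
  where open ≤-Reasoning

module _ {m n v : ℕ} {G : Graph v} (E : EdgeSubset G) (1≤n : 1 ≤ n) (2n≤m : 2 * n ≤ m)
         (min-degree : MinDegreeAtLeast G (1 + n)) (|E|≡n : edgeCount E ≡ n)
         (tough : ∀ S → 2 ≤ iso G S → iso G S ≤ (m ∸ n) * card S) where

  private
    G′ : Graph v
    G′ = deleteEdges G E

  edgeDegree≤n : ∀ x → edgeDegree E x ≤ n
  edgeDegree≤n x = subst (edgeDegree E x ≤_) |E|≡n (edgeDegree≤edgeCount E x)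

  iso-deleteEdges-empty : (S : VSet v) → card S ≡ 0 → iso G′ S ≡ 0
  iso-deleteEdges-empty S |S|≡0 = count≡0 (isolatedIn G′ S) λ x iso′ →
    <⇒≱ (min-degree x) (≤-trans (degree-isolated E iso′)
                                 (subst (λ k → k + edgeDegree E x ≤ n) (sym |S|≡0) (edgeDegree≤n x)))

  iso-deleteEdges-single : (S : VSet v) → card S ≡ 1 → iso G′ S ≤ 2
  iso-deleteEdges-single S |S|≡1 = *-cancelˡ-≤ n {{>-nonZero 1≤n}} (begin
    n * iso G′ S                                  ≡⟨ cong (n *_) (count≡sum (isolatedIn G′ S)) ⟩
    n * sum (indicator ∘ isolatedIn G′ S)         ≡⟨ *-distribˡ-sum n (indicator ∘ isolatedIn G′ S) ⟩
    sum (λ x → n * indicator (isolatedIn G′ S x)) ≤⟨ sum-mono pointwise ⟩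
    sum (edgeDegree E)                            ≡⟨ handshake E ⟩
    2 * edgeCount E                               ≡⟨ cong (2 *_) |E|≡n ⟩
    2 * n                                         ≡⟨ *-comm 2 n ⟩
    n * 2                                         ∎)
    where
    open ≤-Reasoning
    pointwise : ∀ x → n * indicator (isolatedIn G′ S x) ≤ edgeDegree E x
    pointwise x with isolatedIn G′ S x in iso′
    ... | false = ≤-trans (≤-reflexive (*-zeroʳ n)) z≤n
    ... | true  = ≤-trans (≤-reflexive (*-identityʳ n)) (+-cancelˡ-≤ 1 n (edgeDegree E x)
                    (≤-trans (min-degree x) (subst (λ k → degree G x ≤ k + edgeDegree E x) |S|≡1
                      (degree-isolated E (subst T (sym iso′) tt)))))

  iso-deleteEdges-large : (S : VSet v) → 2 ≤ card S → iso G′ S ≤ m * card S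
  iso-deleteEdges-large S 2≤|S| with 2 ≤? iso G S
  ... | yes 2≤iso = begin
    iso G′ S                       ≤⟨ iso-deleteEdges E S ⟩
    iso G S + 2 * edgeCount E      ≡⟨ cong (λ k → iso G S + 2 * k) |E|≡n ⟩
    iso G S + 2 * n                ≤⟨ +-monoˡ-≤ (2 * n) (tough S 2≤iso) ⟩
    (m ∸ n) * card S + 2 * n       ≤⟨ [m∸n]*s+2*n≤m*s (≤-trans (m≤m+n n (n + 0)) 2n≤m) 2≤|S| ⟩
    m * card S                     ∎
    where open ≤-Reasoning
  ... | no  2≰iso = begin
    iso G′ S                       ≤⟨ iso-deleteEdges E S ⟩
    iso G S + 2 * edgeCount E      ≡⟨ cong (λ k → iso G S + 2 * k) |E|≡n ⟩
    iso G S + 2 * n                ≤⟨ +-monoˡ-≤ (2 * n) (≤-pred (≰⇒> 2≰iso)) ⟩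
    1 + 2 * n                      ≤⟨ 1+2*n≤m*s 1≤n 2n≤m 2≤|S| ⟩
    m * card S                     ∎
    where open ≤-Reasoning

  iso-deleteEdges-bound : (S : VSet v) → iso G′ S ≤ m * card S
  iso-deleteEdges-bound S with card S in |S|
  ... | zero        = ≤-trans (≤-reflexive (iso-deleteEdges-empty S |S|)) z≤n
  ... | suc zero    = ≤-trans (iso-deleteEdges-single S |S|) (≤-trans (2n≤m⇒2≤m 1≤n 2n≤m) (m≤m*n m 1))
  ... | suc (suc _) = subst (λ s → iso G′ S ≤ m * s) |S|
                        (iso-deleteEdges-large S (subst (2 ≤_) (sym |S|) (s≤s (s≤s z≤n))))

theorem5 : (m n : ℕ) → 1 ≤ m → 1 ≤ n → 2 * n ≤ m →
    (v : ℕ) (G : Graph v) → MinDegreeAtLeast G (1 + n) →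
    (∀ (r : ℚ) → IsIsolatedToughness G r → recip (m ∸ n) ≤ℚ r) →
    (E' : EdgeSubset G) → edgeCount E' ≡ n →
    StarFactor (deleteEdges G E') m
theorem5 m n _ 1≤n 2n≤m v G min-degree tough E′ |E′|≡n =
  star-factor-criterion (deleteEdges G E′) (2n≤m⇒2≤m 1≤n 2n≤m)
    (iso-deleteEdges-bound E′ 1≤n 2n≤m min-degree |E′|≡n tough-bound)
  where
  n<m : n < m
  n<m = <-≤-trans (m<m+n n (≤-trans 1≤n (m≤m+n n 0))) 2n≤m
  tough-bound : ∀ S → 2 ≤ iso G S → iso G S ≤ (m ∸ n) * card S
  tough-bound with m ∸ n | m<n⇒0<n∸m n<m
  ... | suc q | _ = isolated-toughness-bound G q tough
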